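{- Let $k>1$, let $\mathcal{X}=(\Omega,S)$ be a $\{1,k\}$-scheme, let $x,y,z\in S_k$ and $r,s\in S$ with $x\sim z\sim y$, $r\in x^*z$, $s\in z^*y$. Suppose $q\in N(\{x,y,z\})$, $u,v,w\in S$ and $t\in rs$ satisfy $u\in x^*q$, $v\in y^*q$, $w\in z^*q$, $x^*z\cap uw^*=\{r\}$, $z^*y\cap wv^*=\{s\}$ and $x^*y\cap uv^*=\{t\}$ (so that $r$ and $s$ are linked with respect to $(x,y,z)$). Fix $\alpha\in\Omega$ and for $a\in S$, $b,c\in S_k$ put $a_{b,c}=a\cap(\alpha b\times\alpha c)$. Then $$r_{x,z}\cdot s_{z,y}\subseteq t_{x,y},$$ with equality if $x\sim y$.
   Context: An association scheme on a finite set $\Omega$ is a pair $(\Omega,S)$ where $S$ is a partition of $\Omega\times\Omega$ with $1_\Omega\in S$, $S^*=S$ ($r^*$ the transpose), and $c_{rs}^t=|\alpha r\cap\beta s^*|$ independent of $(\alpha,\beta)\in t$, where $\alpha r=\{\beta:(\alpha,\beta)\in r\}$. Valency $n_s=|\alpha s|$; a $\{1,k\}$-scheme has all valencies in $\{1,k\}$ with both occurring; $S_k=\{x\in S:n_x=k\}$. For relations $a,b$, $a\cdot b=\{(\alpha,\beta):\exists\gamma,(\alpha,\gamma)\in a,(\gamma,\beta)\in b\}$; for $a,b\in S$ the complex product $ab\subseteq S$ is the set of basis relations contained in $a\cdot b$. For $x,y\in S_k$, $x\sim y$ means $c_{xs}^y=1$ for all $s\in x^*y$ (equivalently $|x^*y|=k$).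 For $T\subseteq S$, $N(T)=\{y\in S_k: y\sim x\ \forall x\in T\}$. -}

module Defs where

open import Data.Nat using (ℕ; zero; suc; _+_)
open import Data.Bool using (Bool; true; false; if_then_else_; _∧_)
open import Data.Fin using (Fin; zero; suc; _≟_)
open import Data.Product using (Σ; ∃; ∃₂; _×_; _,_)
open import Data.Sum using (_⊎_)
open import Relation.Nullary.Decidable using (⌊_⌋)
open import Relation.Binary.PropositionalEquality using (_≡_)

count : ∀ {n} → (Fin n → Bool) → ℕ
count {zero}  f = 0
count {suc n} f = (if f zero then 1 else 0) + count (λ i → f (suc i))

-- |α r ∩ β s*| = #{γ : (α,γ) ∈ r, (γ,β) ∈ s}, for a colouring rel of Ω×Ω
cnt : ∀ {n m} → (Fin n → Fin n → Fin m) → Fin n → Fin n → Fin m → Fin m → ℕ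
cnt rel α β r s = count (λ γ → ⌊ rel α γ ≟ r ⌋ ∧ ⌊ rel γ β ≟ s ⌋)

-- An association scheme on Ω = Fin n with basis relations indexed by Fin m:
-- rel α β is the (unique) basis relation containing (α , β).
record Scheme : Set where
  field
    n m        : ℕ
    rel        : Fin n → Fin n → Fin m
    rel-onto   : ∀ r → ∃₂ λ α β → rel α β ≡ r
    one        : Fin m
    one-diag⇒  : ∀ α β → rel α β ≡ one → α ≡ β
    one-diag⇐  : ∀ α → rel α α ≡ one
    _*         : Fin m → Fin m
    star-rel   : ∀ α β → rel β α ≡ (rel α β) *
    int-const  : ∀ r s t α β α' β' → rel α β ≡ t → rel α' β' ≡ t →
                 cnt rel α β r s ≡ cnt rel α' β' r s

module SchemeNotions (X : Scheme) where
  open Scheme X public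

  HasVal : Fin m → ℕ → Set
  HasVal x k = ∀ α → count (λ β → ⌊ rel α β ≟ x ⌋) ≡ k

  IsOneK : ℕ → Set
  IsOneK k = (∀ x → HasVal x 1 ⊎ HasVal x k)
           × (∃ λ x → HasVal x 1) × (∃ λ x → HasVal x k)

  IntNum : Fin m → Fin m → Fin m → ℕ → Set
  IntNum r s t c = ∀ α β → rel α β ≡ t → cnt rel α β r s ≡ c

  InProd : Fin m → Fin m → Fin m → Set
  InProd a b t = ∀ α β → rel α β ≡ t → ∃ λ γ → rel α γ ≡ a × rel γ β ≡ b

  Sim : ℕ → Fin m → Fin m → Set
  Sim k x y = HasVal x k × HasVal y k × (∀ s → InProd (x *) y s → IntNum x s y 1)

  InN3 : ℕ → Fin m → Fin m → Fin m → Fin m → Set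
  InN3 k x y z q = HasVal q k × Sim k q x × Sim k q y × Sim k q z

  Restr : Fin n → Fin m → Fin m → Fin m → Fin n → Fin n → Set
  Restr α a b c β γ = rel β γ ≡ a × rel α β ≡ b × rel α γ ≡ c

-- Fix α and γ ∈ αy, and pick ε ∈ αq with (γ, ε) ∈ v.  Since u ∈ x*q and w ∈ z*q
-- there are β' ∈ αx and δ' ∈ αz with (β', ε) ∈ u and (δ', ε) ∈ w.  Each side of the
-- triangle (β', δ', γ) lies in the corresponding intersection x*z ∩ uw*, z*y ∩ wv*,
-- x*y ∩ uv*, which are the singletons {r}, {s}, {t}; so the triangle realises r, s, t.
-- Given β ∈ αx, δ ∈ αz with (β, δ) ∈ r, (δ, γ) ∈ s, the relation z ∼ y forces δ = δ'
-- and then x ∼ z forces β = β'.  Conversely, for (β, γ) ∈ t the relation x ∼ y forces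
-- β = β', and δ' is the required middle point.
module Submission where

open import Defs
open import Data.Nat using (ℕ; _<_; zero; suc; pred)
open import Data.Bool using (Bool; true; false; T; _∧_)
open import Data.Bool.Properties using (T-∧)
open import Data.Fin using (Fin; zero; suc; _≟_)
open import Data.Product using (∃; ∃₂; _×_; _,_)
open import Data.Empty using (⊥-elim)
open import Function using (_∘_; _⇔_; mk⇔; Equivalence)
open import Relation.Nullary.Decidable using (⌊_⌋; toWitness; fromWitness)
open import Relation.Binary.PropositionalEquality
  using (_≡_; _≢_; refl; sym; trans; cong; subst)

T⇒count≢0 : ∀ {n} (f : Fin n → Bool) {i} → T (f i) → count f ≢ 0
T⇒count≢0 f {zero}  fi with f zero
... | true = λ ()
T⇒count≢0 f {suc i} fi with f zero
... | true  = λ ()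
... | false = T⇒count≢0 (f ∘ suc) fi

count≢0⇒∃T : ∀ {n} (f : Fin n → Bool) → count f ≢ 0 → ∃ (T ∘ f)
count≢0⇒∃T {zero}  f c≢0 = ⊥-elim (c≢0 refl)
count≢0⇒∃T {suc n} f c≢0 with f zero in eq
... | true  = zero , subst T (sym eq) _
... | false with count≢0⇒∃T (f ∘ suc) c≢0
...   | i , fi = suc i , fi

count≡1⇒T-unique : ∀ {n} (f : Fin n → Bool) → count f ≡ 1 →
                   ∀ {i j} → T (f i) → T (f j) → i ≡ j
count≡1⇒T-unique {suc n} f c≡1 {zero}  {zero}  fi fj = refl
count≡1⇒T-unique {suc n} f c≡1 {zero}  {suc j} fi fj with f zero
... | true = ⊥-elim (T⇒count≢0 (f ∘ suc) fj (cong pred c≡1))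
count≡1⇒T-unique {suc n} f c≡1 {suc i} {zero}  fi fj with f zero
... | true = ⊥-elim (T⇒count≢0 (f ∘ suc) fi (cong pred c≡1))
count≡1⇒T-unique {suc n} f c≡1 {suc i} {suc j} fi fj with f zero
... | true  = ⊥-elim (T⇒count≢0 (f ∘ suc) fi (cong pred c≡1))
... | false = cong suc (count≡1⇒T-unique (f ∘ suc) c≡1 fi fj)

module SchemeProperties (X : Scheme) where
  open SchemeNotions X

  ProductsMeetAt : Fin m → Fin m → Fin m → Fin m → Fin m → Set
  ProductsMeetAt a b c d e = ∀ f → InProd a b f × InProd c d f → f ≡ e

  rel-transpose : ∀ {α β a} → rel α β ≡ a → rel β α ≡ a *
  rel-transpose {α} {β} eq = trans (star-rel α β) (cong _* eq)

  *-involutive : ∀ a → a * * ≡ a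
  *-involutive a with rel-onto a
  ... | α , β , eq = trans (cong _* (sym (rel-transpose eq))) (trans (sym (star-rel β α)) eq)

  rel-transpose⁻ : ∀ {α β a} → rel α β ≡ a * → rel β α ≡ a
  rel-transpose⁻ {a = a} eq = trans (rel-transpose eq) (*-involutive a)

  midpoint? : Fin n → Fin n → Fin m → Fin m → Fin n → Bool
  midpoint? α β a b γ = ⌊ rel α γ ≟ a ⌋ ∧ ⌊ rel γ β ≟ b ⌋

  T-midpoint⇔ : ∀ {α β a b γ} → T (midpoint? α β a b γ) ⇔ (rel α γ ≡ a × rel γ β ≡ b)
  T-midpoint⇔ {α} {β} {a} {b} {γ} =
    mk⇔ (λ h → let (p , q) = Equivalence.to (T-∧ {⌊ rel α γ ≟ a ⌋}) h in toWitness p , toWitness q)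
        (λ (p , q) → Equivalence.from (T-∧ {⌊ rel α γ ≟ a ⌋}) (fromWitness p , fromWitness q))

  triangle⇒InProd : ∀ {α β γ a b c} →
                    rel α γ ≡ a → rel γ β ≡ b → rel α β ≡ c → InProd a b c
  triangle⇒InProd {α} {β} {γ} {a} {b} {c} αγ γβ αβ α' β' α'β' =
    let c-αβ≢0    = T⇒count≢0 (midpoint? α β a b) (Equivalence.from T-midpoint⇔ (αγ , γβ))
        c-α'β'≢0  = subst (_≢ 0) (int-const a b c α β α' β' αβ α'β') c-αβ≢0
        (γ' , mid) = count≢0⇒∃T (midpoint? α' β' a b) c-α'β'≢0
    in γ' , Equivalence.to T-midpoint⇔ mid

  InProd⇒triangle : ∀ {a b c} → InProd a b c →
                    ∃₂ λ α β → ∃ λ γ → rel α γ ≡ a × rel γ β ≡ b × rel α β ≡ c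
  InProd⇒triangle {c = c} P with rel-onto c
  ... | α , β , αβ with P α β αβ
  ...   | γ , αγ , γβ = α , β , γ , αγ , γβ , αβ

  InProd-flipˡ : ∀ {a b c} → InProd (a *) b c → InProd a c b
  InProd-flipˡ P with InProd⇒triangle P
  ... | α , β , γ , αγ , γβ , αβ = triangle⇒InProd (rel-transpose⁻ αγ) αβ γβ

  InProd-flipʳ : ∀ {a b c} → InProd (a *) b c → InProd b (c *) a
  InProd-flipʳ P with InProd⇒triangle P
  ... | α , β , γ , αγ , γβ , αβ = triangle⇒InProd γβ (rel-transpose αβ) (rel-transpose⁻ αγ)

  Sim⇒midpoint-unique : ∀ {k a b s α β γ γ'} → Sim k a b → rel α β ≡ b →
                        rel α γ ≡ a → rel γ β ≡ s → rel α γ' ≡ a → rel γ' β ≡ s → γ ≡ γ'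
  Sim⇒midpoint-unique {a = a} {s = s} {α} {β} (_ , _ , unique) αβ αγ γβ αγ' γ'β =
    count≡1⇒T-unique (midpoint? α β a s)
      (unique s (triangle⇒InProd (rel-transpose αγ) αβ γβ) α β αβ)
      (Equivalence.from T-midpoint⇔ (αγ , γβ)) (Equivalence.from T-midpoint⇔ (αγ' , γ'β))

  ProductsMeetAt⇒side : ∀ {a b c d e α β δ ε} → ProductsMeetAt (a *) c b (d *) e →
                        rel α β ≡ a → rel α δ ≡ c → rel β ε ≡ b → rel δ ε ≡ d → rel β δ ≡ e
  ProductsMeetAt⇒side meet αβ αδ βε δε =
    meet _ ( triangle⇒InProd (rel-transpose αβ) αδ refl
           , triangle⇒InProd βε (rel-transpose δε) refl )

  linked-triangle : ∀ {x y z q u v w r s t} →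
                    InProd (x *) q u → InProd (y *) q v → InProd (z *) q w →
                    ProductsMeetAt (x *) z u (w *) r →
                    ProductsMeetAt (z *) y w (v *) s →
                    ProductsMeetAt (x *) y u (v *) t →
                    ∀ {α γ} → rel α γ ≡ y →
                    ∃₂ λ β δ → rel α β ≡ x × rel α δ ≡ z ×
                               rel β δ ≡ r × rel δ γ ≡ s × rel β γ ≡ t
  linked-triangle Pu Pv Pw meet-r meet-s meet-t {α} {γ} αγ
    with InProd-flipʳ Pv α γ αγ
  ... | ε , αε , εγ with InProd-flipˡ Pu α ε αε | InProd-flipˡ Pw α ε αε
  ...   | β , αβ , βε | δ , αδ , δε =
    β , δ , αβ , αδ , ProductsMeetAt⇒side meet-r αβ αδ βε δε
                    , ProductsMeetAt⇒side meet-s αδ αγ δε γε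
                    , ProductsMeetAt⇒side meet-t αβ αγ βε γε
    where γε = rel-transpose⁻ εγ

lemma4p1 : (X : Scheme) → let open SchemeNotions X in
    (k : ℕ) → 1 < k → IsOneK k →
    (x y z r s : Fin m) →
    HasVal x k → HasVal y k → HasVal z k →
    Sim k x z → Sim k z y →
    InProd (x *) z r → InProd (z *) y s →
    (q u v w t : Fin m) →
    InN3 k x y z q →
    InProd r s t →
    InProd (x *) q u → InProd (y *) q v → InProd (z *) q w →
    -- x*z ∩ uw* = {r}, z*y ∩ wv* = {s}, x*y ∩ uv* = {t}
    InProd u (w *) r →
    (∀ a → (InProd (x *) z a × InProd u (w *) a → a ≡ r)) →
    InProd w (v *) s →
    (∀ a → (InProd (z *) y a × InProd w (v *) a → a ≡ s)) →
    InProd (x *) y t → InProd u (v *) t →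
    (∀ a → (InProd (x *) y a × InProd u (v *) a → a ≡ t)) →
    (α : Fin n) →
    (∀ β γ δ → Restr α r x z β δ → Restr α s z y δ γ → Restr α t x y β γ)
    × (Sim k x y → ∀ β γ → Restr α t x y β γ →
         ∃ λ δ → Restr α r x z β δ × Restr α s z y δ γ)
lemma4p1 X k _ _ x y z r s _ _ _ x∼z z∼y _ _ q u v w t _ _ Pu Pv Pw _ meet-r _ meet-s _ _ meet-t α =
  included , covered
  where
  open SchemeNotions X
  open SchemeProperties X

  triangle : ∀ {γ} → rel α γ ≡ y →
             ∃₂ λ β δ → rel α β ≡ x × rel α δ ≡ z × rel β δ ≡ r × rel δ γ ≡ s × rel β γ ≡ t
  triangle = linked-triangle Pu Pv Pw meet-r meet-s meet-t

  included : ∀ β γ δ → Restr α r x z β δ → Restr α s z y δ γ → Restr α t x y β γ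
  included β γ δ (βδ , αβ , αδ) (δγ , _ , αγ) =
    let (β' , δ' , αβ' , αδ' , β'δ' , δ'γ , β'γ) = triangle αγ
        δ'≡δ = Sim⇒midpoint-unique z∼y αγ αδ' δ'γ αδ δγ
        β'δ  = subst (λ d → rel β' d ≡ r) δ'≡δ β'δ'
        β'≡β = Sim⇒midpoint-unique x∼z αδ αβ' β'δ αβ βδ
    in subst (λ b → rel b γ ≡ t) β'≡β β'γ , αβ , αγ

  covered : Sim k x y → ∀ β γ → Restr α t x y β γ → ∃ λ δ → Restr α r x z β δ × Restr α s z y δ γ
  covered x∼y β γ (βγ , αβ , αγ) =
    let (β' , δ' , αβ' , αδ' , β'δ' , δ'γ , β'γ) = triangle αγ
        β'≡β = Sim⇒midpoint-unique x∼y αγ αβ' β'γ αβ βγ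
    in δ' , (subst (λ b → rel b δ' ≡ r) β'≡β β'δ' , αβ , αδ') , (δ'γ , αδ' , αγ)
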